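{- Let $G$ be a finite simple graph that is $\delta$-dense, and suppose that $G$ and $G^2$ have nested solutions. Label $V_G=\{0,1,\dots,|V_G|-1\}$ according to an optimal order of $G$. Let $\mathcal{O}$ be a compressed optimal order on $G^2$ (with respect to this labeling). Then $\mathcal{O}$ is the lexicographic order $\mathcal{L}$ or the colexicographic order $\mathcal{C}$ on $V_G\times V_G$.
   Context: All graphs are finite and simple. For a graph $G=(V,E)$ and $A\subseteq V$, let $I_G(A)$ be the set of edges of $G$ with both endpoints in $A$, and for $0\le m\le |V|$ let $I_G(m)=\max_{A\subseteq V,\,|A|=m}|I_G(A)|$. A set $A$ with $|A|=m$ and $|I_G(A)|=I_G(m)$ is called optimal. $G$ has nested solutions (NS) if there are sets $A_1\subseteq\cdots\subseteq A_{|V|}$ with $|A_i|=i$ and each $A_i$ optimal; the resulting total order on $V$ (in which the vertex of $A_i\setminus A_{i-1}$ is the $i$-th vertex) is called an optimal order, and labeling the vertices $0,1,\dots,|V|-1$ in this order makes every initial segment $\{0,\dots,k-1\}$ optimal. The $\delta$-sequence of $G$ is $\delta_G(m)=I_G(m)-I_G(m-1)$, $1\le m\le |V|$. Partition $\delta_G$ into consecutive maximal strictly increasing runs ("monotonic segments"); let $r$ be their number and $s_{G,i}$ the first value of the $i$-th run. $G$ is $\delta$-dense iff $s_{G,2},\dots,s_{G,r}>1$. $G^2=G\square G$ has vertex set $V_G\times V_G$, with $(x,y)\sim(u,v)$ iff ($x=u$ and $\{y,v\}\in E_G$) or ($\{x,u\}\in E_G$ and $y=v$). A set $A\subseteq V_G\times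 V_G$ is compressed if for every $a$, the sets $\{y:(a,y)\in A\}$ and $\{x:(x,a)\in A\}$ are each of the form $\{0,1,\dots,k-1\}$ for some $k\ge 0$. A compressed optimal order on $G^2$ is a total order on $V_G\times V_G$ such that every initial segment is both compressed and optimal in $G^2$. The lexicographic order: $(x_1,x_2)<_{\mathcal{L}}(y_1,y_2)$ iff $x_1<y_1$, or $x_1=y_1$ and $x_2<y_2$. The colexicographic order: $(x_1,x_2)<_{\mathcal{C}}(y_1,y_2)$ iff $x_2<y_2$, or $x_2=y_2$ and $x_1<y_1$. -}

module Defs where

open import Data.Nat using (ℕ; zero; suc; _+_; _∸_; _≤_; _<_; _⊔_; _≡ᵇ_)
open import Data.Bool using (Bool; true; false; if_then_else_; _∧_; _∨_)
open import Data.Fin using (Fin; toℕ)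
open import Data.Fin.Properties using (_≟_)
open import Data.List using (List; []; _∷_; map; _++_; length; take; foldr; allFin; concatMap)
open import Data.Nat.ListAction using (sum)
open import Data.List.Membership.Propositional using (_∈_)
open import Data.List.Relation.Unary.Unique.Propositional using (Unique)
open import Data.List.Relation.Binary.Permutation.Propositional using (_↭_)
open import Data.Product using (Σ; _×_; _,_; proj₁; proj₂; ∃)
open import Data.Sum using (_⊎_)
open import Function.Bundles using (_⇔_)
open import Relation.Binary.PropositionalEquality using (_≡_)
open import Relation.Nullary.Decidable using (⌊_⌋)

-- Generic finite graphs: a vertex type V, a duplicate-free complete
-- enumeration `enum : List V` of V, and a Boolean adjacency relation.
-- Vertex sets are represented by duplicate-free lists of vertices.

pairs : ∀ {V : Set} → List V → List (V × V)
pairs []       = []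
pairs (x ∷ xs) = map (λ y → (x , y)) xs ++ pairs xs

edgeCount : ∀ {V : Set} → (V → V → Bool) → List V → ℕ
edgeCount adj A = sum (map (λ p → if adj (proj₁ p) (proj₂ p) then 1 else 0) (pairs A))

sublists : ∀ {V : Set} → List V → List (List V)
sublists []       = [] ∷ []
sublists (x ∷ xs) = sublists xs ++ map (x ∷_) (sublists xs)

Imax : ∀ {V : Set} → List V → (V → V → Bool) → ℕ → ℕ
Imax enum adj m =
  foldr _⊔_ 0 (map (λ A → if length A ≡ᵇ m then edgeCount adj A else 0) (sublists enum))

Optimal : ∀ {V : Set} → List V → (V → V → Bool) → List V → ℕ → Set
Optimal enum adj A m = Unique A × length A ≡ m × edgeCount adj A ≡ Imax enum adj m

-- a total order on V, given as a list listing every vertex exactly once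
-- (a permutation of the enumeration); its initial segments are `take k ord`.
IsOrder : ∀ {V : Set} → List V → List V → Set
IsOrder enum ord = ord ↭ enum

IsOptimalOrder : ∀ {V : Set} → List V → (V → V → Bool) → List V → Set
IsOptimalOrder enum adj ord =
  IsOrder enum ord × (∀ k → k ≤ length enum → Optimal enum adj (take k ord) k)

HasNS : ∀ {V : Set} → List V → (V → V → Bool) → Set
HasNS enum adj = ∃ λ ord → IsOptimalOrder enum adj ord

δseq : ∀ {V : Set} → List V → (V → V → Bool) → ℕ → ℕ
δseq enum adj m = Imax enum adj m ∸ Imax enum adj (m ∸ 1)

-- δ-dense: the first value of every monotonic segment other than the first
-- exceeds 1.  Position m (2 ≤ m ≤ |V|) starts a new maximal strictly
-- increasing run exactly when δ(m) ≤ δ(m-1).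
DeltaDense : ∀ {V : Set} → List V → (V → V → Bool) → Set
DeltaDense enum adj =
  ∀ m → 2 ≤ m → m ≤ length enum →
    δseq enum adj m ≤ δseq enum adj (m ∸ 1) → 1 < δseq enum adj m

SimpleGraph : ℕ → Set
SimpleGraph n = Σ (Fin n → Fin n → Bool) λ adj →
  (∀ x y → adj x y ≡ adj y x) × (∀ x → adj x x ≡ false)

lexList : (n : ℕ) → List (Fin n × Fin n)
lexList n = concatMap (λ x → map (λ y → (x , y)) (allFin n)) (allFin n)

colexList : (n : ℕ) → List (Fin n × Fin n)
colexList n = concatMap (λ y → map (λ x → (x , y)) (allFin n)) (allFin n)

sqAdj : ∀ {n} → (Fin n → Fin n → Bool) → (Fin n × Fin n) → (Fin n × Fin n) → Bool
sqAdj adj (x , y) (u , v) = (⌊ x ≟ u ⌋ ∧ adj y v) ∨ (adj x u ∧ ⌊ y ≟ v ⌋)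

Compressed : ∀ {n} → List (Fin n × Fin n) → Set
Compressed {n} A = ∀ a →
  (∃ λ k → ∀ y → ((a , y) ∈ A) ⇔ (toℕ y < k)) ×
  (∃ λ k → ∀ x → ((x , a) ∈ A) ⇔ (toℕ x < k))

IsCompressedOptimalOrder : ∀ {n} → (Fin n → Fin n → Bool) → List (Fin n × Fin n) → Set
IsCompressedOptimalOrder {n} adj ord =
  IsOptimalOrder (lexList n) (sqAdj adj) ord ×
  (∀ k → Compressed (take k ord))

{-# OPTIONS --safe #-}
-- Label V_G = {0, …, n-1} optimally and let backDegree x be the number of neighbours of x among
-- 0, …, x-1, so that backDegree x = δ_G(x+1); δ-density forces backDegree x ≥ 2 for x ≥ 2.
-- Transposing O if necessary, (1,0) is not the second cell of O, and then O fills the rows of G²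
-- one after the other.  Suppose the rows above x and the first r cells of row x are filled.  By
-- compression the next cell is (x,r), or (x+1,0) with r ≥ 1.  If r ≥ 2, or if r = 1 and x ≥ 1
-- (O is then forced down column 0 until it turns to (x,1)), the cells filled after the rows above
-- x form a line of m ≥ 2 cells, spanning at most I_G(m) edges, plus one cell with at most one
-- neighbour on that line.  The lex prefix of the same size has instead a row segment of m + 1
-- cells, spanning I_G(m) + backDegree m ≥ I_G(m) + 2 edges, and no fewer edges to the rows above
-- x, contradicting optimality.  If r = 1 and x = 0, then (1,0) would be the second cell of O.

module Submission where

open import Defs
open import Data.Nat using (ℕ; zero; suc; _+_; _*_; _∸_; _≤_; _<_; _⊔_; _≡ᵇ_; z≤n; s≤s; _≤?_)
open import Data.Nat.Properties
open import Data.Nat.ListAction using (sum)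
open import Data.Nat.ListAction.Properties using (sum-++)
open import Data.Nat.Tactic.RingSolver using (solve-∀)
open import Data.Bool using (Bool; true; false; if_then_else_; _∧_)
open import Data.Bool.Properties using (T-≡; ∧-comm; ∨-comm; ∧-zeroʳ; ∧-identityʳ; ∨-identityʳ)
open import Data.Fin using (Fin; toℕ; fromℕ<) renaming (zero to fzero; suc to fsuc)
open import Data.Fin.Properties using (toℕ<n; toℕ-fromℕ<; toℕ-injective) renaming (_≟_ to _≟ᶠ_)
open import Data.List using (List; []; _∷_; [_]; map; _++_; length; take; drop; foldr; allFin; concatMap; tabulate)
open import Data.List.Properties
  using (map-++; map-∘; map-id; length-++; length-map; length-tabulate; take-all; take-map; take-suc;
         take++drop≡id; ++-assoc; ++-identityʳ; concatMap-++; map-concatMap; concatMap-cong)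
open import Data.List.Membership.Propositional using (_∈_; _∉_)
open import Data.List.Membership.Propositional.Properties
  using (∈-map⁺; ∈-map⁻; ∈-++⁺ˡ; ∈-++⁺ʳ; ∈-++⁻; ∈-concat⁺′; ∈-concat⁻′; ∈-allFin)
open import Data.List.Relation.Unary.Any using (here; there)
open import Data.List.Relation.Unary.All as All using (All; []; _∷_)
import Data.List.Relation.Unary.All.Properties as Allₚ
open import Data.List.Relation.Unary.AllPairs using (_∷_)
open import Data.List.Relation.Unary.Unique.Propositional using (Unique)
import Data.List.Relation.Unary.Unique.Propositional.Properties as Uniqueₚ
open import Data.List.Relation.Binary.Sublist.Propositional using (_⊆_; []; _∷_; _∷ʳ_; ⊆-refl; ⊆-trans; from∈)
open import Data.List.Relation.Binary.Sublist.Propositional.Properties using (take-⊆; drop-⊆; ++⁺; ++⁺ʳ; map⁺)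
open import Data.Product using (_×_; _,_; proj₁; proj₂; ∃; swap)
open import Data.Sum as Sum using (_⊎_; inj₁; inj₂)
open import Data.Empty using (⊥; ⊥-elim)
open import Relation.Binary.Definitions using (tri<; tri≈; tri>)
open import Relation.Binary.PropositionalEquality
  using (_≡_; _≢_; refl; sym; trans; cong; cong₂; subst; module ≡-Reasoning)
open import Relation.Nullary using (¬_; yes; no)
open import Relation.Nullary.Decidable using (⌊_⌋)
open import Function using (_∘_)
open import Function.Bundles using (Equivalence; _⇔_; mk⇔)
open import Data.List.Relation.Binary.Permutation.Propositional.Properties using (↭-length)

private
  variable
    V W : Set

-- Definitionally the summand of edgeCount.
⟦_⟧ : Bool → ℕ
⟦ b ⟧ = if b then 1 else 0

⟦⟧≤1 : ∀ b → ⟦ b ⟧ ≤ 1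
⟦⟧≤1 true  = ≤-refl
⟦⟧≤1 false = z≤n

⟦∧⟧ : ∀ a b → ⟦ a ∧ b ⟧ ≡ ⟦ a ⟧ * ⟦ b ⟧
⟦∧⟧ true  b = sym (*-identityˡ ⟦ b ⟧)
⟦∧⟧ false b = refl

∑[_] : List V → (V → ℕ) → ℕ
∑[ xs ] f = sum (map f xs)

∑-++ : ∀ (xs ys : List V) f → ∑[ xs ++ ys ] f ≡ ∑[ xs ] f + ∑[ ys ] f
∑-++ xs ys f rewrite map-++ f xs ys = sum-++ (map f xs) (map f ys)

∑-+ : ∀ (xs : List V) f g → ∑[ xs ] (λ v → f v + g v) ≡ ∑[ xs ] f + ∑[ xs ] g
∑-+ []       f g = refl
∑-+ (x ∷ xs) f g rewrite ∑-+ xs f g = interchange (f x) (g x) _ _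
  where
  interchange : ∀ a b c d → a + b + (c + d) ≡ a + c + (b + d)
  interchange = solve-∀

∑-*ˡ : ∀ (xs : List V) c f → ∑[ xs ] (λ v → c * f v) ≡ c * ∑[ xs ] f
∑-*ˡ []       c f = sym (*-zeroʳ c)
∑-*ˡ (x ∷ xs) c f rewrite ∑-*ˡ xs c f = sym (*-distribˡ-+ c (f x) _)

∑-cong : ∀ (xs : List V) {f g} → (∀ {v} → v ∈ xs → f v ≡ g v) → ∑[ xs ] f ≡ ∑[ xs ] g
∑-cong []       eq = refl
∑-cong (x ∷ xs) eq = cong₂ _+_ (eq (here refl)) (∑-cong xs (eq ∘ there))

∑-mono : ∀ (xs : List V) {f g} → (∀ {v} → v ∈ xs → f v ≤ g v) → ∑[ xs ] f ≤ ∑[ xs ] g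
∑-mono []       le = z≤n
∑-mono (x ∷ xs) le = +-mono-≤ (le (here refl)) (∑-mono xs (le ∘ there))

∑-const : ∀ (xs : List V) c → ∑[ xs ] (λ _ → c) ≡ length xs * c
∑-const []       c = refl
∑-const (x ∷ xs) c = cong (c +_) (∑-const xs c)

∑-map : ∀ (xs : List W) (h : W → V) f → ∑[ map h xs ] f ≡ ∑[ xs ] (f ∘ h)
∑-map []       h f = refl
∑-map (x ∷ xs) h f = cong (f (h x) +_) (∑-map xs h f)

∑-concatMap : ∀ (xs : List W) (R : W → List V) f → ∑[ concatMap R xs ] f ≡ ∑[ xs ] (λ w → ∑[ R w ] f)
∑-concatMap []       R f = refl
∑-concatMap (x ∷ xs) R f = trans (∑-++ (R x) (concatMap R xs) f) (cong (∑[ R x ] f +_) (∑-concatMap xs R f))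

length-concatMap : ∀ (R : W → List V) xs → length (concatMap R xs) ≡ ∑[ xs ] (length ∘ R)
length-concatMap R []       = refl
length-concatMap R (x ∷ xs) = trans (length-++ (R x)) (cong (length (R x) +_) (length-concatMap R xs))

degreeIn : (V → V → Bool) → V → List V → ℕ
degreeIn adj v xs = ∑[ xs ] (λ u → ⟦ adj u v ⟧)

module _ (adj : V → V → Bool) where

  edgeCount-∷ : ∀ x xs → edgeCount adj (x ∷ xs) ≡ ∑[ xs ] (λ y → ⟦ adj x y ⟧) + edgeCount adj xs
  edgeCount-∷ x xs = trans (∑-++ (map (x ,_) xs) (pairs xs) _)
    (cong (_+ edgeCount adj xs) (∑-map xs (x ,_) _))

  edgeCount-++ : ∀ xs ys →
    edgeCount adj (xs ++ ys) ≡ edgeCount adj xs + edgeCount adj ys + ∑[ ys ] (λ v → degreeIn adj v xs)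
  edgeCount-++ [] ys =
    sym (trans (cong (edgeCount adj ys +_) (trans (∑-const ys 0) (*-zeroʳ (length ys)))) (+-identityʳ _))
  edgeCount-++ (x ∷ xs) ys = begin
    edgeCount adj (x ∷ xs ++ ys)                    ≡⟨ edgeCount-∷ x (xs ++ ys) ⟩
    ∑[ xs ++ ys ] (λ y → ⟦ adj x y ⟧) + edgeCount adj (xs ++ ys)
      ≡⟨ cong₂ _+_ (∑-++ xs ys _) (edgeCount-++ xs ys) ⟩
    (a + b) + (e + f + d)                           ≡⟨ shuffle a b e f d ⟩
    (a + e) + f + (b + d)
      ≡⟨ cong₂ (λ u w → u + f + w) (edgeCount-∷ x xs) (∑-+ ys (λ v → ⟦ adj x v ⟧) (λ v → degreeIn adj v xs)) ⟨
    edgeCount adj (x ∷ xs) + f + ∑[ ys ] (λ v → degreeIn adj v (x ∷ xs)) ∎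
    where
    open ≡-Reasoning
    a = ∑[ xs ] (λ y → ⟦ adj x y ⟧)
    b = ∑[ ys ] (λ y → ⟦ adj x y ⟧)
    e = edgeCount adj xs
    f = edgeCount adj ys
    d = ∑[ ys ] (λ v → degreeIn adj v xs)
    shuffle : ∀ a b e f d → (a + b) + (e + f + d) ≡ (a + e) + f + (b + d)
    shuffle = solve-∀

  edgeCount-∷ʳ : ∀ xs v → edgeCount adj (xs ++ [ v ]) ≡ edgeCount adj xs + degreeIn adj v xs
  edgeCount-∷ʳ xs v = trans (edgeCount-++ xs [ v ])
    (cong₂ _+_ (+-identityʳ (edgeCount adj xs)) (+-identityʳ (degreeIn adj v xs)))

edgeCount-map : ∀ (adj : V → V → Bool) (adj′ : W → W → Bool) (f : V → W) →
  (∀ u v → adj′ (f u) (f v) ≡ adj u v) → ∀ xs → edgeCount adj′ (map f xs) ≡ edgeCount adj xs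
edgeCount-map adj adj′ f f-hom []       = refl
edgeCount-map adj adj′ f f-hom (x ∷ xs) = begin
  edgeCount adj′ (f x ∷ map f xs)                          ≡⟨ edgeCount-∷ adj′ (f x) (map f xs) ⟩
  ∑[ map f xs ] (λ y → ⟦ adj′ (f x) y ⟧) + edgeCount adj′ (map f xs)
    ≡⟨ cong₂ _+_ (trans (∑-map xs f _) (∑-cong xs (λ {v} _ → cong ⟦_⟧ (f-hom x v))))
                 (edgeCount-map adj adj′ f f-hom xs) ⟩
  ∑[ xs ] (λ y → ⟦ adj x y ⟧) + edgeCount adj xs           ≡⟨ edgeCount-∷ adj x xs ⟨
  edgeCount adj (x ∷ xs) ∎
  where open ≡-Reasoning

∈-sublists : ∀ {xs ys : List V} → xs ⊆ ys → xs ∈ sublists ys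
∈-sublists []                  = here refl
∈-sublists (y ∷ʳ xs⊆ys)        = ∈-++⁺ˡ (∈-sublists xs⊆ys)
∈-sublists {ys = _ ∷ ys} (refl ∷ xs⊆ys) = ∈-++⁺ʳ (sublists ys) (∈-map⁺ _ (∈-sublists xs⊆ys))

≤-foldr-⊔ : ∀ {m ms} → m ∈ ms → m ≤ foldr _⊔_ 0 ms
≤-foldr-⊔ {ms = m ∷ ms} (here refl) = m≤m⊔n m _
≤-foldr-⊔ {ms = m ∷ ms} (there p)   = ≤-trans (≤-foldr-⊔ p) (m≤n⊔m m _)

edgeCount≤Imax : ∀ {V : Set} (enum : List V) (adj : V → V → Bool) {A} → A ⊆ enum → edgeCount adj A ≤ Imax enum adj (length A)
edgeCount≤Imax {V} enum adj {A} A⊆enum =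
  subst (_≤ Imax enum adj (length A)) candidate-A (≤-foldr-⊔ (∈-map⁺ candidate (∈-sublists A⊆enum)))
  where
  candidate : List V → ℕ
  candidate B = if length B ≡ᵇ length A then edgeCount adj B else 0
  candidate-A : candidate A ≡ edgeCount adj A
  candidate-A rewrite Equivalence.to T-≡ (≡⇒≡ᵇ (length A) (length A) refl) = refl

optimal-maximal : ∀ {enum} {adj : V → V → Bool} {A B m} → Optimal enum adj B m →
  A ⊆ enum → length A ≡ m → edgeCount adj A ≤ edgeCount adj B
optimal-maximal {enum = enum} {adj} (_ , _ , B-max) A⊆enum refl =
  subst (_ ≤_) (sym B-max) (edgeCount≤Imax enum adj A⊆enum)

unique-∷ʳ⇒∉ : ∀ (xs : List V) {e} → Unique (xs ++ [ e ]) → e ∉ xs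
unique-∷ʳ⇒∉ (x ∷ xs) (x∉ ∷ _)  (here refl) with Allₚ.++⁻ʳ xs x∉
... | x≢x ∷ [] = x≢x refl
unique-∷ʳ⇒∉ (x ∷ xs) (_ ∷ !xs) (there e∈) = unique-∷ʳ⇒∉ xs !xs e∈

lexIndex<n² : ∀ {n q r} → q < n → r < n → suc (q * n + r) ≤ n * n
lexIndex<n² {n} {q} {r} q<n r<n = begin
  suc (q * n + r) ≡⟨ +-suc (q * n) r ⟨
  q * n + suc r   ≤⟨ +-monoʳ-≤ (q * n) r<n ⟩
  q * n + n       ≡⟨ +-comm (q * n) n ⟩
  suc q * n       ≤⟨ *-monoˡ-≤ n q<n ⟩
  n * n ∎
  where open ≤-Reasoning

module _ {enum : List V} {adj : V → V → Bool} (dense : DeltaDense enum adj) where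

  1≤δseq : ∀ m → 2 ≤ m → m ≤ length enum → 1 ≤ δseq enum adj m
  1≤δseq m 2≤m m≤∣V∣ with δseq enum adj m ≤? δseq enum adj (m ∸ 1)
  ... | yes fall = <⇒≤ (dense m 2≤m m≤∣V∣ fall)
  ... | no rise  = ≤-trans (s≤s z≤n) (≰⇒> rise)

  2≤δseq : ∀ m → 2 ≤ m → suc m ≤ length enum → 2 ≤ δseq enum adj (suc m)
  2≤δseq m 2≤m m<∣V∣ with δseq enum adj (suc m) ≤? δseq enum adj m
  ... | yes fall = dense (suc m) (m≤n⇒m≤1+n 2≤m) m<∣V∣ fall
  ... | no rise  = ≤-trans (s≤s (1≤δseq m 2≤m (<⇒≤ m<∣V∣))) (≰⇒> rise)

module _ {n : ℕ} where

  multiplicity : Fin n → List (Fin n) → ℕ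
  multiplicity y xs = ∑[ xs ] (λ x → ⟦ ⌊ x ≟ᶠ y ⌋ ⟧)

  multiplicity-∉ : ∀ {y} xs → y ∉ xs → multiplicity y xs ≡ 0
  multiplicity-∉ []       y∉ = refl
  multiplicity-∉ {y} (x ∷ xs) y∉ with x ≟ᶠ y
  ... | yes refl = ⊥-elim (y∉ (here refl))
  ... | no _     = multiplicity-∉ xs (y∉ ∘ there)

  multiplicity-∈ : ∀ {y} xs → Unique xs → y ∈ xs → multiplicity y xs ≡ 1
  multiplicity-∈ {y} (x ∷ xs) (x∉xs ∷ !xs) y∈ with x ≟ᶠ y | y∈
  ... | yes refl | _          = cong suc (multiplicity-∉ xs (Allₚ.All¬⇒¬Any x∉xs))
  ... | no x≢y   | here x≡y   = ⊥-elim (x≢y (sym x≡y))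
  ... | no _     | there y∈xs = multiplicity-∈ xs !xs y∈xs

  multiplicity≤1 : ∀ {y} xs → Unique xs → multiplicity y xs ≤ 1
  multiplicity≤1 {y} [] _ = z≤n
  multiplicity≤1 {y} (x ∷ xs) (x∉xs ∷ !xs) with x ≟ᶠ y
  ... | yes refl = ≤-reflexive (cong suc (multiplicity-∉ xs (Allₚ.All¬⇒¬Any x∉xs)))
  ... | no _     = multiplicity≤1 xs !xs

-- Stated for an arbitrary tabulate f, so that induction on n goes through.
private
  window : ∀ {n} → (Fin n → V) → ℕ → ℕ → List V
  window f k m = take m (drop k (tabulate f))

  ∈-window : ∀ {n} (f : Fin n → V) k m {u} → u ∈ window f k m →
             ∃ λ i → k ≤ toℕ i × toℕ i < k + m × u ≡ f i
  ∈-window {n = suc n} f zero    (suc m) (here refl) = fzero , z≤n , s≤s z≤n , refl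
  ∈-window {n = suc n} f zero    (suc m) (there u∈) with ∈-window (f ∘ fsuc) zero m u∈
  ... | i , _ , i<m , refl = fsuc i , z≤n , s≤s i<m , refl
  ∈-window {n = zero}  f (suc k) zero    ()
  ∈-window {n = zero}  f (suc k) (suc m) ()
  ∈-window {n = suc n} f (suc k) m u∈ with ∈-window (f ∘ fsuc) k m u∈
  ... | i , k≤i , i<k+m , refl = fsuc i , s≤s k≤i , s≤s i<k+m , refl

  window-∈ : ∀ {n} (f : Fin n → V) k m i → k ≤ toℕ i → toℕ i < k + m → f i ∈ window f k m
  window-∈ f zero    (suc m) fzero    _         _           = here refl
  window-∈ f zero    (suc m) (fsuc i) _         (s≤s i<m)   = there (window-∈ (f ∘ fsuc) zero m i z≤n i<m)
  window-∈ f (suc k) m       (fsuc i) (s≤s k≤i) (s≤s i<k+m) = window-∈ (f ∘ fsuc) k m i k≤i i<k+m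

  window-∷ʳ : ∀ {n} (f : Fin n → V) k m i → toℕ i ≡ k + m → window f k (suc m) ≡ window f k m ++ [ f i ]
  window-∷ʳ f zero    zero    fzero    _  = refl
  window-∷ʳ f zero    (suc m) (fsuc i) eq = cong (f fzero ∷_) (window-∷ʳ (f ∘ fsuc) zero m i (suc-injective eq))
  window-∷ʳ f (suc k) m       (fsuc i) eq = window-∷ʳ (f ∘ fsuc) k m i (suc-injective eq)

  length-window : ∀ {n} (f : Fin n → V) k m → k + m ≤ n → length (window f k m) ≡ m
  length-window f       k       zero    _         = refl
  length-window {n = suc n} f zero    (suc m) (s≤s le) = cong suc (length-window (f ∘ fsuc) zero m le)
  length-window {n = suc n} f (suc k) (suc m) (s≤s le) = length-window (f ∘ fsuc) k (suc m) le

interval : ∀ {n} → ℕ → ℕ → List (Fin n)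
interval k m = window (λ i → i) k m

module _ {n : ℕ} where

  ∈-interval : ∀ k m {u : Fin n} → u ∈ interval k m → k ≤ toℕ u × toℕ u < k + m
  ∈-interval k m u∈ with ∈-window (λ i → i) k m u∈
  ... | _ , k≤i , i<k+m , refl = k≤i , i<k+m

  interval-∈ : ∀ k m {u : Fin n} → k ≤ toℕ u → toℕ u < k + m → u ∈ interval k m
  interval-∈ k m = window-∈ (λ i → i) k m _

  interval-∷ʳ : ∀ k m {u : Fin n} → toℕ u ≡ k + m → interval k (suc m) ≡ interval k m ++ [ u ]
  interval-∷ʳ k m = window-∷ʳ (λ i → i) k m _

  length-interval : ∀ k m → k + m ≤ n → length (interval {n} k m) ≡ m
  length-interval = length-window (λ i → i)

  interval-unique : ∀ k m → Unique (interval {n} k m)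
  interval-unique k m = Uniqueₚ.take⁺ m (Uniqueₚ.drop⁺ k (Uniqueₚ.allFin⁺ n))

  interval⊆allFin : ∀ k m → interval {n} k m ⊆ allFin n
  interval⊆allFin k m = ⊆-trans (take-⊆ m (drop k (allFin n))) (drop-⊆ k (allFin n))

  interval-all : interval {n} 0 n ≡ allFin n
  interval-all = take-all n (allFin n) (≤-reflexive (length-tabulate (λ i → i)))

module _ {n : ℕ} {B : List (Fin n × Fin n)} {a b : Fin n} (compressed : Compressed (B ++ [ (a , b) ])) where

  compressed-∷ʳ-row : ∀ {b′} → toℕ b′ < toℕ b → (a , b′) ∈ B
  compressed-∷ʳ-row {b′} b′<b with proj₁ (compressed a)
  ... | k , row-a
    with ∈-++⁻ B (Equivalence.from (row-a b′) (<-trans b′<b (Equivalence.to (row-a b) (∈-++⁺ʳ B (here refl)))))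
  ...   | inj₁ ∈B           = ∈B
  ...   | inj₂ (here b′≡b) = ⊥-elim (<-irrefl (cong (toℕ ∘ proj₂) b′≡b) b′<b)

  compressed-∷ʳ-col : ∀ {a′} → toℕ a′ < toℕ a → (a′ , b) ∈ B
  compressed-∷ʳ-col {a′} a′<a with proj₂ (compressed b)
  ... | k , col-b
    with ∈-++⁻ B (Equivalence.from (col-b a′) (<-trans a′<a (Equivalence.to (col-b a) (∈-++⁺ʳ B (here refl)))))
  ...   | inj₁ ∈B           = ∈B
  ...   | inj₂ (here a′≡a) = ⊥-elim (<-irrefl (cong (toℕ ∘ proj₁) a′≡a) a′<a)

vertexBelow : ∀ {n i} (v : Fin n) → i < toℕ v → ∃ λ (u : Fin n) → toℕ u ≡ i
vertexBelow v i<v = fromℕ< (<-trans i<v (toℕ<n v)) , toℕ-fromℕ< _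

module Grid (n : ℕ) where

  Cell : Set
  Cell = Fin n × Fin n

  row : Fin n → List (Fin n) → List Cell
  row x B = map (x ,_) B

  col : Fin n → List (Fin n) → List Cell
  col y C = map (_, y) C

  ∈-row : ∀ {a b x B} → (a , b) ∈ row x B → a ≡ x × b ∈ B
  ∈-row a,b∈ with ∈-map⁻ _ a,b∈
  ... | _ , b∈ , refl = refl , b∈

  ∈-col : ∀ {a b y C} → (a , b) ∈ col y C → b ≡ y × a ∈ C
  ∈-col a,b∈ with ∈-map⁻ _ a,b∈
  ... | _ , a∈ , refl = refl , a∈

  FromRow : ℕ → Cell → Set
  FromRow q c = q ≤ toℕ (proj₁ c)

  rows : ℕ → List Cell
  rows q = concatMap (λ x → row x (allFin n)) (interval 0 q)

  ∈-rows : ∀ q {a b} → (a , b) ∈ rows q → toℕ a < q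
  ∈-rows q a,b∈ with ∈-concat⁻′ (map (λ x → row x (allFin n)) (interval 0 q)) a,b∈
  ... | _ , a,b∈row , row∈ with ∈-map⁻ _ row∈
  ... | x , x∈ , refl with ∈-row a,b∈row
  ... | refl , _ = proj₂ (∈-interval 0 q x∈)

  rows-∈ : ∀ q {a} b → toℕ a < q → (a , b) ∈ rows q
  rows-∈ q b a<q = ∈-concat⁺′ (∈-map⁺ _ (∈-allFin b)) (∈-map⁺ _ (interval-∈ 0 q z≤n a<q))

  rows-∷ʳ : ∀ q {x} → toℕ x ≡ q → rows (suc q) ≡ rows q ++ row x (allFin n)
  rows-∷ʳ q {x} x≡q = begin
    rows (suc q)                                          ≡⟨ cong (concatMap _) (interval-∷ʳ 0 q x≡q) ⟩
    concatMap _ (interval 0 q ++ [ x ])                   ≡⟨ concatMap-++ _ (interval 0 q) [ x ] ⟩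
    rows q ++ row x (allFin n) ++ []                      ≡⟨ cong (rows q ++_) (++-identityʳ _) ⟩
    rows q ++ row x (allFin n) ∎
    where open ≡-Reasoning

  length-rows : ∀ q → q ≤ n → length (rows q) ≡ q * n
  length-rows q q≤n = begin
    length (rows q)                                         ≡⟨ length-concatMap _ (interval 0 q) ⟩
    ∑[ interval 0 q ] (λ x → length (row x (allFin n)))   ≡⟨ ∑-cong (interval 0 q) (λ _ → length-row) ⟩
    ∑[ interval 0 q ] (λ _ → n)                             ≡⟨ ∑-const (interval 0 q) n ⟩
    length (interval {n} 0 q) * n                           ≡⟨ cong (_* n) (length-interval 0 q q≤n) ⟩
    q * n ∎
    where
    open ≡-Reasoning
    length-row : ∀ {x} → length (row x (allFin n)) ≡ n
    length-row = trans (length-map _ (allFin n)) (length-tabulate (λ i → i))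

  rows-all : rows n ≡ lexList n
  rows-all = cong (concatMap (λ x → row x (allFin n))) interval-all

  rows⊆lexList : ∀ q → rows q ⊆ lexList n
  rows⊆lexList q = subst (rows q ⊆_) rows++rest≡lexList (++⁺ʳ _ ⊆-refl)
    where
    rows++rest≡lexList : rows q ++ concatMap (λ x → row x (allFin n)) (drop q (allFin n)) ≡ lexList n
    rows++rest≡lexList = trans (sym (concatMap-++ _ (take q (allFin n)) _))
                               (cong (concatMap _) (take++drop≡id q (allFin n)))

  length-lexList : length (lexList n) ≡ n * n
  length-lexList = trans (cong length (sym rows-all)) (length-rows n ≤-refl)

  lexPrefix : Fin n → ℕ → List Cell
  lexPrefix x r = rows (toℕ x) ++ row x (interval 0 r)

  ∈-lexPrefix : ∀ x r {a b} → (a , b) ∈ lexPrefix x r → toℕ a < toℕ x ⊎ (a ≡ x × toℕ b < r)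
  ∈-lexPrefix x r a,b∈ with ∈-++⁻ (rows (toℕ x)) a,b∈
  ... | inj₁ ∈rows = inj₁ (∈-rows (toℕ x) ∈rows)
  ... | inj₂ ∈row with ∈-row ∈row
  ...   | refl , b∈ = inj₂ (refl , proj₂ (∈-interval 0 r b∈))

  lexPrefix-∈ʳ : ∀ x r {b} → toℕ b < r → (x , b) ∈ lexPrefix x r
  lexPrefix-∈ʳ x r b<r = ∈-++⁺ʳ (rows (toℕ x)) (∈-map⁺ _ (interval-∈ 0 r z≤n b<r))

  lexPrefix-∷ʳ : ∀ x r {b} → toℕ b ≡ r → lexPrefix x (suc r) ≡ lexPrefix x r ++ [ (x , b) ]
  lexPrefix-∷ʳ x r {b} b≡r = begin
    rows (toℕ x) ++ row x (interval 0 (suc r))          ≡⟨ cong (λ B → rows (toℕ x) ++ row x B) (interval-∷ʳ 0 r b≡r) ⟩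
    rows (toℕ x) ++ row x (interval 0 r ++ [ b ])       ≡⟨ cong (rows (toℕ x) ++_) (map-++ _ (interval 0 r) [ b ]) ⟩
    rows (toℕ x) ++ row x (interval 0 r) ++ [ (x , b) ] ≡⟨ ++-assoc (rows (toℕ x)) _ _ ⟨
    lexPrefix x r ++ [ (x , b) ] ∎
    where open ≡-Reasoning

  lexPrefix-full : ∀ x → lexPrefix x n ≡ rows (suc (toℕ x))
  lexPrefix-full x = trans (cong (λ B → rows (toℕ x) ++ row x B) interval-all) (sym (rows-∷ʳ (toℕ x) refl))

  length-lexPrefix : ∀ x r → r ≤ n → length (lexPrefix x r) ≡ toℕ x * n + r
  length-lexPrefix x r r≤n = trans (length-++ (rows (toℕ x)))
    (cong₂ _+_ (length-rows (toℕ x) (<⇒≤ (toℕ<n x)))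
               (trans (length-map _ (interval 0 r)) (length-interval 0 r r≤n)))

  lexPrefix⊆lexList : ∀ x r → lexPrefix x r ⊆ lexList n
  lexPrefix⊆lexList x r = ⊆-trans (subst (lexPrefix x r ⊆_) (sym (rows-∷ʳ (toℕ x) refl))
                                          (++⁺ ⊆-refl (map⁺ _ (interval⊆allFin 0 r))))
                                  (rows⊆lexList (suc (toℕ x)))

  columnRun : Fin n → Fin n → ℕ → List Cell
  columnRun x z s = rows (toℕ x) ++ col z (interval (toℕ x) s)

  ∈-columnRun : ∀ x z s {a b} → (a , b) ∈ columnRun x z s →
    toℕ a < toℕ x ⊎ (b ≡ z × toℕ a < toℕ x + s)
  ∈-columnRun x z s a,b∈ with ∈-++⁻ (rows (toℕ x)) a,b∈
  ... | inj₁ ∈rows = inj₁ (∈-rows (toℕ x) ∈rows)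
  ... | inj₂ ∈col with ∈-col ∈col
  ...   | refl , a∈ = inj₂ (refl , proj₂ (∈-interval (toℕ x) s a∈))

  columnRun-∈ʳ : ∀ x z s {a} → toℕ x ≤ toℕ a → toℕ a < toℕ x + s → (a , z) ∈ columnRun x z s
  columnRun-∈ʳ x z s x≤a a<x+s = ∈-++⁺ʳ (rows (toℕ x)) (∈-map⁺ _ (interval-∈ (toℕ x) s x≤a a<x+s))

  columnRun-∷ʳ : ∀ x z s {a} → toℕ a ≡ toℕ x + s → columnRun x z (suc s) ≡ columnRun x z s ++ [ (a , z) ]
  columnRun-∷ʳ x z s {a} a≡x+s = begin
    rows q ++ col z (interval q (suc s))        ≡⟨ cong (λ C → rows q ++ col z C) (interval-∷ʳ q s a≡x+s) ⟩
    rows q ++ col z (interval q s ++ [ a ])     ≡⟨ cong (rows q ++_) (map-++ _ (interval q s) [ a ]) ⟩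
    rows q ++ col z (interval q s) ++ [ (a , z) ] ≡⟨ ++-assoc (rows q) _ _ ⟨
    columnRun x z s ++ [ (a , z) ] ∎
    where
    open ≡-Reasoning
    q = toℕ x

  lexPrefix-origin : ∀ x z → toℕ x ≡ 0 → toℕ z ≡ 0 → lexPrefix x 1 ≡ [ (x , z) ]
  lexPrefix-origin x z x≡0 z≡0 = cong₂ (λ q B → rows q ++ row x B) x≡0 (interval-∷ʳ 0 0 z≡0)

  lexPrefix-turn : ∀ x z {a} → toℕ z ≡ 0 → toℕ a ≡ suc (toℕ x) →
    lexPrefix x 1 ++ [ (a , z) ] ≡ columnRun x z 2
  lexPrefix-turn x z {a} z≡0 a≡x+1 = begin
    lexPrefix x 1 ++ [ (a , z) ]                    ≡⟨ cong (_++ [ (a , z) ]) (lexPrefix-∷ʳ x 0 z≡0) ⟩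
    (lexPrefix x 0 ++ [ (x , z) ]) ++ [ (a , z) ]
      ≡⟨ cong (_++ [ (a , z) ]) (columnRun-∷ʳ x z 0 (sym (+-identityʳ _))) ⟨
    columnRun x z 1 ++ [ (a , z) ]                  ≡⟨ columnRun-∷ʳ x z 1 (trans a≡x+1 (+-comm 1 (toℕ x))) ⟨
    columnRun x z 2 ∎
    where open ≡-Reasoning

  lexPrefix-successor : ∀ x r {a b} → Compressed (lexPrefix x r ++ [ (a , b) ]) → (a , b) ∉ lexPrefix x r →
    (a ≡ x × toℕ b ≡ r) ⊎ (toℕ a ≡ suc (toℕ x) × toℕ b ≡ 0 × 0 < r)
  lexPrefix-successor x r {a} {b} compressed fresh with <-cmp (toℕ a) (toℕ x)
  ... | tri< a<x _ _ = ⊥-elim (fresh (∈-++⁺ˡ (rows-∈ (toℕ x) b a<x)))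
  ... | tri≈ _ a≡x _ rewrite toℕ-injective a≡x = inj₁ (refl , sameRow)
    where
    sameRow : toℕ b ≡ r
    sameRow with <-cmp (toℕ b) r
    ... | tri< b<r _ _ = ⊥-elim (fresh (lexPrefix-∈ʳ x r b<r))
    ... | tri≈ _ b≡r _ = b≡r
    ... | tri> _ _ r<b with vertexBelow b r<b
    ...   | v , v≡r with ∈-lexPrefix x r (compressed-∷ʳ-row compressed (subst (_< toℕ b) (sym v≡r) r<b))
    ...     | inj₁ x<x       = ⊥-elim (<-irrefl refl x<x)
    ...     | inj₂ (_ , v<r) = ⊥-elim (<-irrefl v≡r v<r)
  ... | tri> _ _ x<a = inj₂ (nextRow , firstColumn , ≤-<-trans z≤n b<r)
    where
    b<r : toℕ b < r
    b<r with ∈-lexPrefix x r (compressed-∷ʳ-col compressed x<a)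
    ... | inj₁ x<x       = ⊥-elim (<-irrefl refl x<x)
    ... | inj₂ (_ , b<r) = b<r
    nextRow : toℕ a ≡ suc (toℕ x)
    nextRow with <-cmp (toℕ a) (suc (toℕ x))
    ... | tri< a≤x _ _ = ⊥-elim (<⇒≱ x<a (≤-pred a≤x))
    ... | tri≈ _ a≡x+1 _ = a≡x+1
    ... | tri> _ _ x+1<a with vertexBelow a x+1<a
    ...   | u , u≡x+1 with ∈-lexPrefix x r (compressed-∷ʳ-col compressed (subst (_< toℕ a) (sym u≡x+1) x+1<a))
    ...     | inj₁ u<x        = ⊥-elim (1+n≰n (<⇒≤ (subst (_< toℕ x) u≡x+1 u<x)))
    ...     | inj₂ (refl , _) = ⊥-elim (1+n≢n (sym u≡x+1))
    firstColumn : toℕ b ≡ 0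
    firstColumn = n≤0⇒n≡0 (≮⇒≥ λ 0<b → leftOfB 0<b (vertexBelow b 0<b))
      where
      leftOfB : 0 < toℕ b → ∃ (λ v → toℕ v ≡ 0) → ⊥
      leftOfB 0<b (v , v≡0) with ∈-lexPrefix x r (compressed-∷ʳ-row compressed (subst (_< toℕ b) (sym v≡0) 0<b))
      ... | inj₁ a<x        = <-asym a<x x<a
      ... | inj₂ (refl , _) = <-irrefl refl x<a

  columnRun-successor : ∀ x z s {a b} → toℕ z ≡ 0 → Compressed (columnRun x z s ++ [ (a , b) ]) →
    (a , b) ∉ columnRun x z s → (toℕ a ≡ toℕ x + s × b ≡ z) ⊎ (a ≡ x × toℕ b ≡ 1)
  columnRun-successor x z s {a} {b} z≡0 compressed fresh with toℕ b ≟ 0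
  ... | yes b≡0 rewrite toℕ-injective (trans b≡0 (sym z≡0)) = inj₁ (columnEnd , refl)
    where
    columnEnd : toℕ a ≡ toℕ x + s
    columnEnd with <-cmp (toℕ a) (toℕ x + s)
    ... | tri< a<x+s _ _ with toℕ a <? toℕ x
    ...   | yes a<x = ⊥-elim (fresh (∈-++⁺ˡ (rows-∈ (toℕ x) z a<x)))
    ...   | no a≮x  = ⊥-elim (fresh (columnRun-∈ʳ x z s (≮⇒≥ a≮x) a<x+s))
    columnEnd | tri≈ _ a≡x+s _ = a≡x+s
    columnEnd | tri> _ _ x+s<a with vertexBelow a x+s<a
    ... | u , u≡x+s with ∈-columnRun x z s (compressed-∷ʳ-col compressed (subst (_< toℕ a) (sym u≡x+s) x+s<a))
    ...   | inj₁ u<x           = ⊥-elim (<⇒≱ u<x (subst (toℕ x ≤_) (sym u≡x+s) (m≤m+n (toℕ x) s)))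
    ...   | inj₂ (_ , u<x+s)   = ⊥-elim (<-irrefl u≡x+s u<x+s)
  ... | no b≢0 = inj₂ (sameRow , secondColumn)
    where
    sameRow : a ≡ x
    sameRow with <-cmp (toℕ a) (toℕ x)
    ... | tri< a<x _ _ = ⊥-elim (fresh (∈-++⁺ˡ (rows-∈ (toℕ x) b a<x)))
    ... | tri≈ _ a≡x _ = toℕ-injective a≡x
    ... | tri> _ _ x<a with ∈-columnRun x z s (compressed-∷ʳ-col compressed x<a)
    ...   | inj₁ x<x        = ⊥-elim (<-irrefl refl x<x)
    ...   | inj₂ (refl , _) = ⊥-elim (b≢0 z≡0)
    secondColumn : toℕ b ≡ 1
    secondColumn with <-cmp (toℕ b) 1
    ... | tri< b<1 _ _ = ⊥-elim (b≢0 (n<1⇒n≡0 b<1))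
    ... | tri≈ _ b≡1 _ = b≡1
    ... | tri> _ _ 1<b with vertexBelow b 1<b
    ...   | v , v≡1 with ∈-columnRun x z s (compressed-∷ʳ-row compressed (subst (_< toℕ b) (sym v≡1) 1<b))
    ...     | inj₁ a<x        = ⊥-elim (<-irrefl (cong toℕ sameRow) a<x)
    ...     | inj₂ (refl , _) = ⊥-elim (1+n≢0 (trans (sym v≡1) z≡0))

module Square {n : ℕ} (adj : Fin n → Fin n → Bool) (irrefl : ∀ x → adj x x ≡ false) where

  open Grid n public

  sq : Cell → Cell → Bool
  sq = sqAdj adj

  sq-sameRow : ∀ x b y → sq (x , b) (x , y) ≡ adj b y
  sq-sameRow x b y with x ≟ᶠ x
  ... | no x≢x = ⊥-elim (x≢x refl)
  ... | yes _ rewrite irrefl x = ∨-identityʳ (adj b y)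

  sq-sameCol : ∀ a x y → sq (a , y) (x , y) ≡ adj a x
  sq-sameCol a x y with y ≟ᶠ y
  ... | no y≢y = ⊥-elim (y≢y refl)
  ... | yes _ rewrite irrefl y | ∧-zeroʳ ⌊ a ≟ᶠ x ⌋ = ∧-identityʳ (adj a x)

  sq-otherRow : ∀ {x a} → x ≢ a → ∀ b y → sq (x , b) (a , y) ≡ adj x a ∧ ⌊ b ≟ᶠ y ⌋
  sq-otherRow {x} {a} x≢a b y with x ≟ᶠ a
  ... | yes x≡a = ⊥-elim (x≢a x≡a)
  ... | no _    = refl

  sq-otherCol : ∀ {b y} → b ≢ y → ∀ a x → sq (a , b) (x , y) ≡ ⌊ a ≟ᶠ x ⌋ ∧ adj b y
  sq-otherCol {b} {y} b≢y a x with b ≟ᶠ y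
  ... | yes b≡y = ⊥-elim (b≢y b≡y)
  ... | no _ rewrite ∧-zeroʳ (adj a x) = ∨-identityʳ _

  edgeCount-row : ∀ x B → edgeCount sq (row x B) ≡ edgeCount adj B
  edgeCount-row x = edgeCount-map adj sq (x ,_) (sq-sameRow x)

  edgeCount-col : ∀ y C → edgeCount sq (col y C) ≡ edgeCount adj C
  edgeCount-col y = edgeCount-map adj sq (_, y) (λ a x → sq-sameCol a x y)

  degreeIn-otherRow : ∀ {x a} → x ≢ a → ∀ b B →
    degreeIn sq (a , b) (row x B) ≡ ⟦ adj x a ⟧ * multiplicity b B
  degreeIn-otherRow {x} {a} x≢a b B = begin
    degreeIn sq (a , b) (row x B)               ≡⟨ ∑-map B _ _ ⟩
    ∑[ B ] (λ y → ⟦ sq (x , y) (a , b) ⟧)      ≡⟨ ∑-cong B (λ _ → cong ⟦_⟧ (sq-otherRow x≢a _ b)) ⟩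
    ∑[ B ] (λ y → ⟦ adj x a ∧ ⌊ y ≟ᶠ b ⌋ ⟧)    ≡⟨ ∑-cong B (λ {y} _ → ⟦∧⟧ (adj x a) _) ⟩
    ∑[ B ] (λ y → ⟦ adj x a ⟧ * ⟦ ⌊ y ≟ᶠ b ⌋ ⟧) ≡⟨ ∑-*ˡ B ⟦ adj x a ⟧ _ ⟩
    ⟦ adj x a ⟧ * multiplicity b B ∎
    where open ≡-Reasoning

  degreeIn-otherRow≤1 : ∀ {x a} → x ≢ a → ∀ b {B} → Unique B → degreeIn sq (a , b) (row x B) ≤ 1
  degreeIn-otherRow≤1 {x} {a} x≢a b {B} !B = subst (_≤ 1) (sym (degreeIn-otherRow x≢a b B))
    (*-mono-≤ (⟦⟧≤1 (adj x a)) (multiplicity≤1 B !B))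

  degreeIn-otherCol≤1 : ∀ {y b} → y ≢ b → ∀ a {C} → Unique C → degreeIn sq (a , b) (col y C) ≤ 1
  degreeIn-otherCol≤1 {y} {b} y≢b a {C} !C = begin
    degreeIn sq (a , b) (col y C)               ≡⟨ ∑-map C _ _ ⟩
    ∑[ C ] (λ x → ⟦ sq (x , y) (a , b) ⟧)      ≡⟨ ∑-cong C (λ _ → cong ⟦_⟧ (sq-otherCol y≢b _ a)) ⟩
    ∑[ C ] (λ x → ⟦ ⌊ x ≟ᶠ a ⌋ ∧ adj y b ⟧)    ≤⟨ ∑-mono C (λ {x} _ → ∧-⟦⟧≤ ⌊ x ≟ᶠ a ⌋ (adj y b)) ⟩
    multiplicity a C                            ≤⟨ multiplicity≤1 C !C ⟩
    1 ∎
    where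
    open ≤-Reasoning
    ∧-⟦⟧≤ : ∀ p q → ⟦ p ∧ q ⟧ ≤ ⟦ p ⟧
    ∧-⟦⟧≤ true  q = ⟦⟧≤1 q
    ∧-⟦⟧≤ false q = z≤n

  degreeIn-rows : ∀ q {a} b → q ≤ toℕ a → degreeIn sq (a , b) (rows q) ≡ degreeIn adj a (interval 0 q)
  degreeIn-rows q {a} b q≤a = trans (∑-concatMap (interval 0 q) _ _) (∑-cong (interval 0 q) row-contribution)
    where
    row-contribution : ∀ {x} → x ∈ interval 0 q → degreeIn sq (a , b) (row x (allFin n)) ≡ ⟦ adj x a ⟧
    row-contribution {x} x∈ = begin
      degreeIn sq (a , b) (row x (allFin n)) ≡⟨ degreeIn-otherRow x≢a b (allFin n) ⟩
      ⟦ adj x a ⟧ * multiplicity b (allFin n)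
        ≡⟨ cong (⟦ adj x a ⟧ *_) (multiplicity-∈ _ (Uniqueₚ.allFin⁺ n) (∈-allFin b)) ⟩
      ⟦ adj x a ⟧ * 1                        ≡⟨ *-identityʳ _ ⟩
      ⟦ adj x a ⟧ ∎
      where
      open ≡-Reasoning
      x≢a : x ≢ a
      x≢a refl = <⇒≱ (proj₂ (∈-interval 0 q x∈)) q≤a

  edgeCount-rows-++ : ∀ q C → All (FromRow q) C →
    edgeCount sq (rows q ++ C) ≡
    edgeCount sq (rows q) + edgeCount sq C + ∑[ C ] (λ c → degreeIn adj (proj₁ c) (interval 0 q))
  edgeCount-rows-++ q C below = trans (edgeCount-++ sq (rows q) C)
    (cong (edgeCount sq (rows q) + edgeCount sq C +_) (∑-cong C (λ c∈ → degreeIn-rows q _ (All.lookup below c∈))))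

module OptimalLabelling {n : ℕ} (adj : Fin n → Fin n → Bool) (irrefl : ∀ x → adj x x ≡ false)
  (initial-optimal : ∀ k → k ≤ n → Optimal (allFin n) adj (take k (allFin n)) k)
  (dense : DeltaDense (allFin n) adj) where

  open Square adj irrefl public

  -- I_G(m), by optimality of the initial segments.
  I : ℕ → ℕ
  I m = edgeCount adj (interval {n} 0 m)

  backDegree : Fin n → ℕ
  backDegree x = degreeIn adj x (interval 0 (toℕ x))

  I-suc : ∀ x → I (suc (toℕ x)) ≡ I (toℕ x) + backDegree x
  I-suc x = trans (cong (edgeCount adj) (interval-∷ʳ 0 (toℕ x) refl)) (edgeCount-∷ʳ adj (interval 0 (toℕ x)) x)

  edgeCount-interval≤I : ∀ k m → k + m ≤ n → edgeCount adj (interval k m) ≤ I m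
  edgeCount-interval≤I k m k+m≤n = optimal-maximal (initial-optimal m (≤-trans (m≤n+m m k) k+m≤n))
    (interval⊆allFin k m) (length-interval k m k+m≤n)

  degreeIn≤backDegree : ∀ x a → toℕ x ≤ toℕ a → degreeIn adj a (interval 0 (toℕ x)) ≤ backDegree x
  degreeIn≤backDegree x a x≤a = +-cancelˡ-≤ (I q) _ _ (begin
    I q + degreeIn adj a (interval 0 q)     ≡⟨ edgeCount-∷ʳ adj (interval 0 q) a ⟨
    edgeCount adj (interval 0 q ++ [ a ])
      ≤⟨ optimal-maximal (initial-optimal (suc q) (toℕ<n x)) extended⊆ length-extended ⟩
    I (suc q)                               ≡⟨ I-suc x ⟩
    I q + backDegree x ∎)
    where
    open ≤-Reasoning
    q = toℕ x
    a∈rest : a ∈ drop q (allFin n)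
    a∈rest with ∈-++⁻ (take q (allFin n)) (subst (a ∈_) (sym (take++drop≡id q (allFin n))) (∈-allFin a))
    ... | inj₁ a∈initial = ⊥-elim (<⇒≱ (proj₂ (∈-interval 0 q a∈initial)) x≤a)
    ... | inj₂ a∈rest = a∈rest
    extended⊆ : interval 0 q ++ [ a ] ⊆ allFin n
    extended⊆ = subst (interval 0 q ++ [ a ] ⊆_) (take++drop≡id q (allFin n)) (++⁺ ⊆-refl (from∈ a∈rest))
    length-extended : length (interval 0 q ++ [ a ]) ≡ suc q
    length-extended = trans (length-++ (interval 0 q))
      (trans (cong (_+ 1) (length-interval 0 q (<⇒≤ (toℕ<n x)))) (+-comm q 1))

  backDegree≥2 : ∀ x → 2 ≤ toℕ x → 2 ≤ backDegree x
  backDegree≥2 x 2≤x = subst (2 ≤_) δ≡backDegree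
    (2≤δseq {enum = allFin n} {adj = adj} dense (toℕ x) 2≤x
      (subst (suc (toℕ x) ≤_) (sym (length-tabulate {n = n} (λ i → i))) (toℕ<n x)))
    where
    I≡Imax : ∀ k → k ≤ n → Imax (allFin n) adj k ≡ I k
    I≡Imax k k≤n = sym (proj₂ (proj₂ (initial-optimal k k≤n)))
    δ≡backDegree : δseq (allFin n) adj (suc (toℕ x)) ≡ backDegree x
    δ≡backDegree = trans (cong₂ _∸_ (I≡Imax (suc (toℕ x)) (toℕ<n x)) (I≡Imax (toℕ x) (<⇒≤ (toℕ<n x))))
      (trans (cong (_∸ I (toℕ x)) (I-suc x)) (m+n∸m≡n (I (toℕ x)) (backDegree x)))

  edgeCount-rows-++≤ : ∀ x C → All (FromRow (toℕ x)) C →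
    edgeCount sq (rows (toℕ x) ++ C) ≤ edgeCount sq (rows (toℕ x)) + edgeCount sq C + length C * backDegree x
  edgeCount-rows-++≤ x C below = begin
    edgeCount sq (rows (toℕ x) ++ C)                                   ≡⟨ edgeCount-rows-++ (toℕ x) C below ⟩
    base + ∑[ C ] (λ c → degreeIn adj (proj₁ c) (interval 0 (toℕ x)))  ≤⟨ +-monoʳ-≤ base (∑-mono C degree-bound) ⟩
    base + ∑[ C ] (λ _ → backDegree x)                                 ≡⟨ cong (base +_) (∑-const C _) ⟩
    base + length C * backDegree x ∎
    where
    open ≤-Reasoning
    base = edgeCount sq (rows (toℕ x)) + edgeCount sq C
    degree-bound : ∀ {c} → c ∈ C → degreeIn adj (proj₁ c) (interval 0 (toℕ x)) ≤ backDegree x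
    degree-bound c∈ = degreeIn≤backDegree x _ (All.lookup below c∈)

  edgeCount-lexPrefix : ∀ x r → r ≤ n →
    edgeCount sq (lexPrefix x r) ≡ edgeCount sq (rows (toℕ x)) + I r + r * backDegree x
  edgeCount-lexPrefix x r r≤n = begin
    edgeCount sq (lexPrefix x r)
      ≡⟨ edgeCount-rows-++ (toℕ x) (row x B) (Allₚ.map⁺ (All.universal (λ _ → ≤-refl) B)) ⟩
    R + edgeCount sq (row x B) + ∑[ row x B ] (λ c → degreeIn adj (proj₁ c) (interval 0 (toℕ x)))
      ≡⟨ cong₂ (λ e d → R + e + d) (edgeCount-row x B) (∑-map B (x ,_) _) ⟩
    R + I r + ∑[ B ] (λ _ → backDegree x)
      ≡⟨ cong (R + I r +_) (trans (∑-const B _) (cong (_* backDegree x) (length-interval 0 r r≤n))) ⟩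
    R + I r + r * backDegree x ∎
    where
    open ≡-Reasoning
    R = edgeCount sq (rows (toℕ x))
    B = interval 0 r

  detour-not-optimal : ∀ x m → 2 ≤ m → m < n → ∀ L e → All (FromRow (toℕ x)) L → FromRow (toℕ x) e →
    length L ≡ m → edgeCount sq L ≤ I m → degreeIn sq e L ≤ 1 →
    ¬ Optimal (lexList n) sq ((rows (toℕ x) ++ L) ++ [ e ]) (suc (toℕ x * n + m))
  detour-not-optimal x m 2≤m m<n L (a , b) L-below e-below ∣L∣≡m L-sparse e-sparse optimal
    with fromℕ< m<n | toℕ-fromℕ< m<n
  ... | w | refl = <⇒≱ (backDegree≥2 w 2≤m) (cancel (begin
    R + (I m + backDegree w) + suc m * d          ≡⟨ cong (λ i → R + i + suc m * d) (I-suc w) ⟨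
    R + I (suc m) + suc m * d                     ≡⟨ edgeCount-lexPrefix x (suc m) m<n ⟨
    edgeCount sq (lexPrefix x (suc m))
      ≤⟨ optimal-maximal optimal (lexPrefix⊆lexList x (suc m)) (trans (length-lexPrefix x (suc m) m<n) (+-suc _ m)) ⟩
    edgeCount sq ((rows q ++ L) ++ [ (a , b) ])   ≡⟨ edgeCount-∷ʳ sq (rows q ++ L) (a , b) ⟩
    edgeCount sq (rows q ++ L) + degreeIn sq (a , b) (rows q ++ L)
      ≡⟨ cong (edgeCount sq (rows q ++ L) +_) (∑-++ (rows q) L _) ⟩
    edgeCount sq (rows q ++ L) + (degreeIn sq (a , b) (rows q) + degreeIn sq (a , b) L)
      ≤⟨ +-mono-≤ (edgeCount-rows-++≤ x L L-below) (+-mono-≤ e-rows e-sparse) ⟩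
    R + edgeCount sq L + length L * d + (d + 1)
      ≤⟨ +-monoˡ-≤ (d + 1) (+-mono-≤ (+-monoʳ-≤ R L-sparse) (≤-reflexive (cong (_* d) ∣L∣≡m))) ⟩
    R + I m + m * d + (d + 1)                     ≡⟨ regroup R (I m) m d ⟩
    R + (I m + 1) + suc m * d ∎))
    where
    open ≤-Reasoning
    q = toℕ x
    d = backDegree x
    R = edgeCount sq (rows q)
    e-rows : degreeIn sq (a , b) (rows q) ≤ d
    e-rows = subst (_≤ d) (sym (degreeIn-rows q b e-below)) (degreeIn≤backDegree x a e-below)
    regroup : ∀ R i m d → R + i + m * d + (d + 1) ≡ R + (i + 1) + suc m * d
    regroup = solve-∀
    cancel : ∀ {u v} → R + (I m + u) + suc m * d ≤ R + (I m + v) + suc m * d → u ≤ v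
    cancel = +-cancelˡ-≤ (I m) _ _ ∘ +-cancelˡ-≤ R _ _ ∘ +-cancelʳ-≤ _ _ _

NotDownFirstColumn : ∀ {n} → List (Fin n × Fin n) → Set
NotDownFirstColumn O = ∀ {u a b} → take 2 O ≡ u ∷ (a , b) ∷ [] → toℕ a ≡ 1 → toℕ b ≢ 0

-- Unlike IsCompressedOptimalOrder, this keeps only the length of O, so it is stable under transposition.
record CompressedOptimalPrefixes {n} (adj : Fin n → Fin n → Bool) (O : List (Fin n × Fin n)) : Set where
  field
    length≡n²  : length O ≡ n * n
    optimal    : ∀ k → k ≤ n * n → Optimal (lexList n) (sqAdj adj) (take k O) k
    compressed : ∀ k → Compressed (take k O)

module LexOrder {n : ℕ} (adj : Fin n → Fin n → Bool) (irrefl : ∀ x → adj x x ≡ false)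
  (initial-optimal : ∀ k → k ≤ n → Optimal (allFin n) adj (take k (allFin n)) k)
  (dense : DeltaDense (allFin n) adj)
  (O : List (Fin n × Fin n)) (O-prefixes : CompressedOptimalPrefixes adj O) (O-notDown : NotDownFirstColumn O) where

  open OptimalLabelling adj irrefl initial-optimal dense
  open CompressedOptimalPrefixes O-prefixes
    renaming (length≡n² to length-O; optimal to O-optimal; compressed to O-compressed)

  record Extension (k : ℕ) (B : List Cell) : Set where
    constructor extension
    field
      next       : Cell
      take-suc≡  : take (suc k) O ≡ B ++ [ next ]
      fresh      : next ∉ B
      compressed : Compressed (B ++ [ next ])
      optimal    : Optimal (lexList n) sq (B ++ [ next ]) (suc k)

  extend : ∀ k {B} → suc k ≤ n * n → take k O ≡ B → Extension k B
  extend k {B} k<n² refl = record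
    { next       = next
    ; take-suc≡  = take-suc≡
    ; fresh      = unique-∷ʳ⇒∉ B (subst Unique take-suc≡ (proj₁ (O-optimal (suc k) k<n²)))
    ; compressed = subst Compressed take-suc≡ (O-compressed (suc k))
    ; optimal    = subst (λ A → Optimal (lexList n) sq A (suc k)) take-suc≡ (O-optimal (suc k) k<n²)
    }
    where
    k<∣O∣ : k < length O
    k<∣O∣ = subst (suc k ≤_) (sym length-O) k<n²
    next = Data.List.lookup O (fromℕ< k<∣O∣)
    take-suc≡ : take (suc k) O ≡ B ++ [ next ]
    take-suc≡ = subst (λ j → take (suc j) O ≡ take j O ++ [ next ]) (toℕ-fromℕ< k<∣O∣)
                      (take-suc O (fromℕ< k<∣O∣))

  columnRun-grows : ∀ x z → toℕ z ≡ 0 → 1 ≤ toℕ x → ∀ s → 2 ≤ s → toℕ x + s ≤ n →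
    take (toℕ x * n + s) O ≡ columnRun x z s →
    toℕ x + s < n × take (toℕ x * n + suc s) O ≡ columnRun x z (suc s)
  columnRun-grows x z z≡0 1≤x s 2≤s x+s≤n prefix = grow (extend (q * n + s) (lexIndex<n² (toℕ<n x) s<n) prefix)
    where
    q = toℕ x
    s<n : s < n
    s<n = ≤-trans (+-monoˡ-≤ s 1≤x) x+s≤n
    grow : Extension (q * n + s) (columnRun x z s) → q + s < n × take (q * n + suc s) O ≡ columnRun x z (suc s)
    grow (extension (a , b) take-suc≡ fresh compressed optimal) with columnRun-successor x z s z≡0 compressed fresh
    ... | inj₁ (a≡x+s , refl) = subst (_< n) a≡x+s (toℕ<n a) ,
      trans (cong (λ k → take k O) (+-suc (q * n) s)) (trans take-suc≡ (sym (columnRun-∷ʳ x z s a≡x+s)))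
    ... | inj₂ (refl , b≡1) = ⊥-elim (detour-not-optimal x s 2≤s s<n (col z S) (x , b)
            (Allₚ.map⁺ (All.tabulate (proj₁ ∘ ∈-interval q s))) ≤-refl
            (trans (length-map _ S) (length-interval q s x+s≤n))
            (subst (_≤ I s) (sym (edgeCount-col z S)) (edgeCount-interval≤I q s x+s≤n))
            (degreeIn-otherCol≤1 z≢b x (interval-unique q s)) optimal)
      where
      S = interval q s
      z≢b : z ≢ b
      z≢b refl = 1+n≢0 (trans (sym b≡1) z≡0)

  columnRun-impossible : ∀ x z → toℕ z ≡ 0 → 1 ≤ toℕ x → ∀ f s → 2 ≤ s → toℕ x + s + f ≡ n →
    take (toℕ x * n + s) O ≡ columnRun x z s → ⊥
  columnRun-impossible x z z≡0 1≤x zero s 2≤s x+s+0≡n prefix =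
    <-irrefl (trans (sym (+-identityʳ _)) x+s+0≡n)
      (proj₁ (columnRun-grows x z z≡0 1≤x s 2≤s (subst (toℕ x + s ≤_) x+s+0≡n (m≤m+n _ 0)) prefix))
  columnRun-impossible x z z≡0 1≤x (suc f) s 2≤s x+s+f≡n prefix =
    columnRun-impossible x z z≡0 1≤x f (suc s) (m≤n⇒m≤1+n 2≤s)
      (trans (cong (_+ f) (+-suc (toℕ x) s)) (trans (sym (+-suc _ f)) x+s+f≡n))
      (proj₂ (columnRun-grows x z z≡0 1≤x s 2≤s (subst (toℕ x + s ≤_) x+s+f≡n (m≤m+n _ (suc f))) prefix))

  rowExit-impossible : ∀ x r {a b} → r < n → toℕ a ≡ suc (toℕ x) → toℕ b ≡ 0 → 0 < r →
    take (suc (toℕ x * n + r)) O ≡ lexPrefix x r ++ [ (a , b) ] →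
    Optimal (lexList n) sq (lexPrefix x r ++ [ (a , b) ]) (suc (toℕ x * n + r)) → ⊥
  rowExit-impossible x (suc zero) {a} {b} _ a≡x+1 b≡0 _ prefix _ with toℕ x ≟ 0
  ... | yes x≡0 = O-notDown origin (trans a≡x+1 (cong suc x≡0)) b≡0
    where
    origin : take 2 O ≡ (x , b) ∷ (a , b) ∷ []
    origin = trans (cong (λ q → take (suc (q * n + 1)) O) (sym x≡0))
                   (trans prefix (cong (_++ [ (a , b) ]) (lexPrefix-origin x b x≡0 b≡0)))
  ... | no x≢0 =
    columnRun-impossible x b b≡0 (n≢0⇒n>0 x≢0) (n ∸ (toℕ x + 2)) 2 ≤-refl (m+[n∸m]≡n x+2≤n)
                   (trans (cong (λ k → take k O) (+-suc _ 1)) (trans prefix (lexPrefix-turn x b b≡0 a≡x+1)))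
    where
    x+2≤n : toℕ x + 2 ≤ n
    x+2≤n = subst (_≤ n) (+-comm 2 (toℕ x)) (subst (_< n) a≡x+1 (toℕ<n a))
  rowExit-impossible x r@(suc (suc _)) {a} {b} r<n a≡x+1 _ _ _ optimal =
    detour-not-optimal x r (s≤s (s≤s z≤n)) r<n (row x R) (a , b)
      (Allₚ.map⁺ (All.universal (λ _ → ≤-refl) R)) (subst (toℕ x ≤_) (sym a≡x+1) (n≤1+n _))
      (trans (length-map _ R) (length-interval 0 r (<⇒≤ r<n)))
      (≤-reflexive (edgeCount-row x R))
      (degreeIn-otherRow≤1 x≢a b (interval-unique 0 r)) optimal
    where
    R = interval 0 r
    x≢a : x ≢ a
    x≢a refl = 1+n≢n (sym a≡x+1)

  lexPrefix-grows : ∀ x r → r < n → take (toℕ x * n + r) O ≡ lexPrefix x r →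
    take (toℕ x * n + suc r) O ≡ lexPrefix x (suc r)
  lexPrefix-grows x r r<n prefix = step (extend (toℕ x * n + r) (lexIndex<n² (toℕ<n x) r<n) prefix)
    where
    step : Extension (toℕ x * n + r) (lexPrefix x r) → take (toℕ x * n + suc r) O ≡ lexPrefix x (suc r)
    step (extension (a , b) take-suc≡ fresh compressed optimal) with lexPrefix-successor x r compressed fresh
    ... | inj₁ (refl , b≡r) =
      trans (cong (λ k → take k O) (+-suc _ r)) (trans take-suc≡ (sym (lexPrefix-∷ʳ x r b≡r)))
    ... | inj₂ (a≡x+1 , b≡0 , 0<r) = ⊥-elim (rowExit-impossible x r r<n a≡x+1 b≡0 0<r take-suc≡ optimal)

  row-fills : ∀ x → take (toℕ x * n) O ≡ rows (toℕ x) → ∀ r → r ≤ n →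
    take (toℕ x * n + r) O ≡ lexPrefix x r
  row-fills x prefix zero    _   = trans (cong (λ k → take k O) (+-identityʳ _)) (trans prefix (sym (++-identityʳ _)))
  row-fills x prefix (suc r) r<n = lexPrefix-grows x r r<n (row-fills x prefix r (<⇒≤ r<n))

  rows-prefix : ∀ q → q ≤ n → take (q * n) O ≡ rows q
  rows-prefix zero    _   = refl
  rows-prefix (suc q) q<n = nextRow (fromℕ< q<n) (toℕ-fromℕ< q<n) (rows-prefix q (<⇒≤ q<n))
    where
    nextRow : ∀ x → toℕ x ≡ q → take (q * n) O ≡ rows q → take (suc q * n) O ≡ rows (suc q)
    nextRow x x≡q prefix = begin
      take (suc q * n) O       ≡⟨ cong (λ k → take k O) (+-comm n (q * n)) ⟩
      take (q * n + n) O       ≡⟨ cong (λ i → take (i * n + n) O) x≡q ⟨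
      take (toℕ x * n + n) O   ≡⟨ row-fills x (subst (λ i → take (i * n) O ≡ rows i) (sym x≡q) prefix) n ≤-refl ⟩
      lexPrefix x n            ≡⟨ lexPrefix-full x ⟩
      rows (suc (toℕ x))       ≡⟨ cong (rows ∘ suc) x≡q ⟩
      rows (suc q) ∎
      where open ≡-Reasoning

  O≡lexList : O ≡ lexList n
  O≡lexList = begin
    O                ≡⟨ take-all (n * n) O (≤-reflexive length-O) ⟨
    take (n * n) O   ≡⟨ rows-prefix n ≤-refl ⟩
    rows n           ≡⟨ rows-all ⟩
    lexList n ∎
    where open ≡-Reasoning

module _ {n : ℕ} where

  ∈-transpose : ∀ {A : List (Fin n × Fin n)} {a b} → (a , b) ∈ map swap A → (b , a) ∈ A
  ∈-transpose a,b∈ with ∈-map⁻ swap a,b∈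
  ... | _ , b,a∈ , refl = b,a∈

  compressed-transpose : ∀ {A : List (Fin n × Fin n)} → Compressed A → Compressed (map swap A)
  compressed-transpose compressed a with compressed a
  ... | (k , row-a) , (l , col-a) = (l , λ y → transposed (col-a y)) , (k , λ x → transposed (row-a x))
    where
    transposed : ∀ {u v P} → (u , v) ∈ _ ⇔ P → (v , u) ∈ map swap _ ⇔ P
    transposed u,v∈⇔P =
      mk⇔ (Equivalence.to u,v∈⇔P ∘ ∈-transpose) (∈-map⁺ swap ∘ Equivalence.from u,v∈⇔P)

  sqAdj-swap : ∀ (adj : Fin n → Fin n → Bool) u v → sqAdj adj (swap u) (swap v) ≡ sqAdj adj u v
  sqAdj-swap adj (x , y) (u , v)
    rewrite ∧-comm ⌊ y ≟ᶠ v ⌋ (adj x u) | ∧-comm (adj y v) ⌊ x ≟ᶠ u ⌋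
    = ∨-comm (adj x u ∧ ⌊ y ≟ᶠ v ⌋) _

  optimal-transpose : ∀ {adj A k} → Optimal (lexList n) (sqAdj adj) A k →
    Optimal (lexList n) (sqAdj adj) (map swap A) k
  optimal-transpose {adj} {A} (unique , length-A , maximal) =
    Uniqueₚ.map⁺ (cong swap) unique ,
    trans (length-map swap A) length-A ,
    trans (edgeCount-map (sqAdj adj) (sqAdj adj) swap (sqAdj-swap adj) A) maximal

  prefixes-transpose : ∀ {adj : Fin n → Fin n → Bool} {O} →
    CompressedOptimalPrefixes adj O → CompressedOptimalPrefixes adj (map swap O)
  prefixes-transpose {adj} {O} O-prefixes = record
    { length≡n²  = trans (length-map swap O) length≡n²
    ; optimal    = λ k k≤n² → subst (λ A → Optimal (lexList n) (sqAdj adj) A k) (sym (take-map k O))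
                                    (optimal-transpose (optimal k k≤n²))
    ; compressed = λ k → subst Compressed (sym (take-map k O)) (compressed-transpose (compressed k))
    }
    where open CompressedOptimalPrefixes O-prefixes

  compressedOptimalOrder⇒prefixes : ∀ {adj : Fin n → Fin n → Bool} {O} →
    IsCompressedOptimalOrder adj O → CompressedOptimalPrefixes adj O
  compressedOptimalOrder⇒prefixes ((O↭lexList , optimal) , compressed) = record
    { length≡n²  = trans (↭-length O↭lexList) length-lexList
    ; optimal    = λ k k≤n² → optimal k (subst (k ≤_) (sym length-lexList) k≤n²)
    ; compressed = compressed
    }
    where open Grid n using (length-lexList)

  transpose-involutive : ∀ (O : List (Fin n × Fin n)) → map swap (map swap O) ≡ O
  transpose-involutive O = trans (sym (map-∘ O)) (map-id O)

  transpose-lexList : map swap (lexList n) ≡ colexList n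
  transpose-lexList = trans (map-concatMap swap _ (allFin n)) (concatMap-cong (λ _ → sym (map-∘ (allFin n))) (allFin n))

  notDown-or-transposed : ∀ (O : List (Fin n × Fin n)) → NotDownFirstColumn O ⊎ NotDownFirstColumn (map swap O)
  notDown-or-transposed []                = inj₁ λ ()
  notDown-or-transposed (_ ∷ [])          = inj₁ λ ()
  notDown-or-transposed (_ ∷ (a , _) ∷ _) with toℕ a ≟ 1
  ... | yes a≡1 = inj₂ λ { refl _ a≡0 → 1+n≢0 (trans (sym a≡1) a≡0) }
  ... | no a≢1  = inj₁ λ { refl a≡1 _ → a≢1 a≡1 }

theorem8 : (n : ℕ) (G : SimpleGraph n) →
    DeltaDense (allFin n) (proj₁ G) →
    HasNS (allFin n) (proj₁ G) →
    HasNS (lexList n) (sqAdj (proj₁ G)) →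
    (∀ k → k ≤ n → Optimal (allFin n) (proj₁ G) (take k (allFin n)) k) →
    (O : List (Fin n × Fin n)) →
    IsCompressedOptimalOrder (proj₁ G) O →
    O ≡ lexList n ⊎ O ≡ colexList n
theorem8 n (adj , _ , irrefl) dense _ _ initial-optimal O O-order =
  Sum.map (isLex O O-prefixes) isColex (notDown-or-transposed O)
  where
  isLex = LexOrder.O≡lexList adj irrefl initial-optimal dense
  O-prefixes = compressedOptimalOrder⇒prefixes O-order
  isColex : NotDownFirstColumn (map swap O) → O ≡ colexList n
  isColex Oᵀ-notDown = begin
    O                      ≡⟨ transpose-involutive O ⟨
    map swap (map swap O)  ≡⟨ cong (map swap) (isLex (map swap O) (prefixes-transpose O-prefixes) Oᵀ-notDown) ⟩
    map swap (lexList n)   ≡⟨ transpose-lexList ⟩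
    colexList n ∎
    where open ≡-Reasoning
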